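{- Let $P$ be a pattern without empty rows or columns. If $P$ has an $m_0\times n_0$ witness, then $P$ has an $m_0\times n_0$ explicit witness.
   Context: All matrices are 0-1 matrices; a pattern is a 0-1 matrix that is not all-zero. A row or column is empty if it contains only 0s. A matrix $M$ contains a pattern $P$ if $P$ can be obtained from $M$ by deleting rows and/or columns and changing arbitrary 1-entries into 0-entries; otherwise $M$ avoids $P$. $M$ is $P$-saturating if it avoids $P$ but changing any single 0-entry of $M$ into a 1 yields a matrix containing $P$. A row (column) of $M$ is $P$-expandable if it is empty and changing any single entry in that row (column) from 0 to 1 creates an occurrence of $P$ in $M$. A witness for $P$ is a matrix that avoids $P$ and has at least one $P$-expandable row and at least one $P$-expandable column. An explicit witness for $P$ is a $P$-saturating matrix that contains at least one empty row and at least one empty column. -}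

module Defs where

open import Data.Nat using (ℕ)
open import Data.Fin using (Fin; _<_; _≟_)
open import Data.Bool using (Bool; true; false; _∧_; _∨_)
open import Data.Product using (Σ; ∃; _×_; ∃-syntax)
open import Relation.Nullary using (¬_; does)
open import Relation.Binary.PropositionalEquality using (_≡_)

Matrix : ℕ → ℕ → Set
Matrix m n = Fin m → Fin n → Bool

IsPattern : ∀ {k l} → Matrix k l → Set
IsPattern P = ∃[ i ] ∃[ j ] P i j ≡ true

StrictMono : ∀ {a b} → (Fin a → Fin b) → Set
StrictMono f = ∀ i i' → i < i' → f i < f i'

Contains : ∀ {m n k l} → Matrix m n → Matrix k l → Set
Contains {m} {n} {k} {l} M P =
  Σ (Fin k → Fin m) λ r → Σ (Fin l → Fin n) λ c →
    StrictMono r × StrictMono c ×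
    (∀ i j → P i j ≡ true → M (r i) (c j) ≡ true)

Avoids : ∀ {m n k l} → Matrix m n → Matrix k l → Set
Avoids M P = ¬ Contains M P

setOne : ∀ {m n} → Matrix m n → Fin m → Fin n → Matrix m n
setOne M i j i' j' = (does (i ≟ i') ∧ does (j ≟ j')) ∨ M i' j'

Saturating : ∀ {m n k l} → Matrix k l → Matrix m n → Set
Saturating P M =
  Avoids M P × (∀ i j → M i j ≡ false → Contains (setOne M i j) P)

EmptyRow : ∀ {m n} → Matrix m n → Fin m → Set
EmptyRow M i = ∀ j → M i j ≡ false

EmptyCol : ∀ {m n} → Matrix m n → Fin n → Set
EmptyCol M j = ∀ i → M i j ≡ false

ExpandableRow : ∀ {m n k l} → Matrix k l → Matrix m n → Fin m → Set
ExpandableRow P M i = EmptyRow M i × (∀ j → Contains (setOne M i j) P)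

ExpandableCol : ∀ {m n k l} → Matrix k l → Matrix m n → Fin n → Set
ExpandableCol P M j = EmptyCol M j × (∀ i → Contains (setOne M i j) P)

Witness : ∀ {m n k l} → Matrix k l → Matrix m n → Set
Witness P M = Avoids M P × (∃[ i ] ExpandableRow P M i) × (∃[ j ] ExpandableCol P M j)

ExplicitWitness : ∀ {m n k l} → Matrix k l → Matrix m n → Set
ExplicitWitness P M = Saturating P M × (∃[ i ] EmptyRow M i) × (∃[ j ] EmptyCol M j)

NoEmptyRows : ∀ {k l} → Matrix k l → Set
NoEmptyRows P = ∀ i → ¬ EmptyRow P i

NoEmptyCols : ∀ {k l} → Matrix k l → Set
NoEmptyCols P = ∀ j → ¬ EmptyCol P j

{-# OPTIONS --safe #-}
-- Saturate M greedily: visit every cell once and turn it into a 1 whenever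
-- this keeps the matrix P-free. The result F ⊒ M avoids P, and every cell is
-- settled (a 1, or turning it into a 1 creates P), so F is P-saturating. An
-- entry in a P-expandable row or column of M must still be 0 in F: turning it
-- into a 1 already creates P inside M, hence inside F.
module Submission where

open import Defs
open import Data.Nat using (ℕ; zero; suc)
open import Data.Bool using (true; false; _∧_)
import Data.Bool as Bool
open import Data.Empty using (⊥-elim)
open import Data.Fin using (Fin; _<_; _≟_; _<?_)
open import Data.Fin.Properties using (any?; all?)
open import Data.List using (List; []; _∷_; allFin; cartesianProduct)
open import Data.List.Membership.Propositional using (_∈_)
open import Data.List.Membership.Propositional.Properties using (∈-allFin; ∈-cartesianProduct⁺)
open import Data.List.Relation.Unary.Any using (here; there)
open import Data.Product using (Σ; ∃; _,_; _×_)
open import Data.Sum using (_⊎_; inj₁; inj₂)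
open import Data.Vec.Functional using (head; tail) renaming (_∷_ to _◂_)
import Data.Fin as Fin
open import Relation.Nullary using (Dec; yes; no; does)
open import Relation.Nullary.Decidable using (_×-dec_; _→-dec_; dec-true)
open import Relation.Unary using (Decidable)
open import Relation.Binary.PropositionalEquality using (_≡_; refl; sym; trans; _≗_; subst; subst₂)

Respects≗ : ∀ {k m} → ((Fin k → Fin m) → Set) → Set
Respects≗ Q = ∀ {f g} → f ≗ g → Q f → Q g

head◂tail-≗ : ∀ {k m} (f : Fin (suc k) → Fin m) → f ≗ head f ◂ tail f
head◂tail-≗ f Fin.zero    = refl
head◂tail-≗ f (Fin.suc i) = refl

-- Without function extensionality the search only recovers a solution up to ≗.
∃-fun? : ∀ k {m} (Q : (Fin k → Fin m) → Set) → Respects≗ Q → Decidable Q → Dec (∃ Q)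
∃-fun? zero Q resp Q? with Q? (λ ())
... | yes q = yes (_ , q)
... | no ¬q = no λ (f , q) → ¬q (resp (λ ()) q)
∃-fun? (suc k) Q resp Q?
  with any? (λ a → ∃-fun? k (λ g → Q (a ◂ g)) (λ e → resp (cons-≗ e)) (λ g → Q? (a ◂ g)))
  where
  cons-≗ : ∀ {a g g'} → g ≗ g' → a ◂ g ≗ a ◂ g'
  cons-≗ e Fin.zero    = refl
  cons-≗ e (Fin.suc i) = e i
... | yes (a , g , q) = yes (a ◂ g , q)
... | no ¬q = no λ (f , q) → ¬q (head f , tail f , resp (head◂tail-≗ f) q)

strictMono? : ∀ {a b} (f : Fin a → Fin b) → Dec (StrictMono f)
strictMono? f = all? λ i → all? λ i' → (i <? i') →-dec (f i <? f i')

StrictMono-resp-≗ : ∀ {a b} → Respects≗ (StrictMono {a} {b})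
StrictMono-resp-≗ e sm i i' i<i' = subst₂ _<_ (e i) (e i') (sm i i' i<i')

contains? : ∀ {m n k l} (M : Matrix m n) (P : Matrix k l) → Dec (Contains M P)
contains? {k = k} {l} M P =
  ∃-fun? k (λ r → ∃ (Embeds r)) resp-rows
    (λ r → ∃-fun? l (Embeds r) (resp-cols r) λ c →
      strictMono? r ×-dec strictMono? c ×-dec ones? r c)
  where
  Embeds : _ → _ → Set
  Embeds r c = StrictMono r × StrictMono c × (∀ i j → P i j ≡ true → M (r i) (c j) ≡ true)

  ones? : ∀ r c → Dec (∀ i j → P i j ≡ true → M (r i) (c j) ≡ true)
  ones? r c = all? λ i → all? λ j → (P i j Bool.≟ true) →-dec (M (r i) (c j) Bool.≟ true)

  resp-cols : ∀ r → Respects≗ (Embeds r)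
  resp-cols r e (sr , sc , ones) =
    sr , StrictMono-resp-≗ e sc , λ i j p → subst (λ x → M (r i) x ≡ true) (e j) (ones i j p)

  resp-rows : Respects≗ (λ r → ∃ (Embeds r))
  resp-rows e (c , sr , sc , ones) =
    c , StrictMono-resp-≗ e sr , sc , λ i j p → subst (λ x → M x (c j) ≡ true) (e i) (ones i j p)

_⊑_ : ∀ {m n} → Matrix m n → Matrix m n → Set
M ⊑ M' = ∀ i j → M i j ≡ true → M' i j ≡ true

⊑-refl : ∀ {m n} {M : Matrix m n} → M ⊑ M
⊑-refl _ _ p = p

⊑-trans : ∀ {m n} {A B C : Matrix m n} → A ⊑ B → B ⊑ C → A ⊑ C
⊑-trans A⊑B B⊑C i j p = B⊑C i j (A⊑B i j p)

Contains-mono : ∀ {m n k l} {M M' : Matrix m n} {P : Matrix k l} → M ⊑ M' → Contains M P → Contains M' P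
Contains-mono M⊑M' (r , c , sr , sc , ones) = r , c , sr , sc , λ i j p → M⊑M' _ _ (ones i j p)

setOne-mono : ∀ {m n} {M M' : Matrix m n} i j → M ⊑ M' → setOne M i j ⊑ setOne M' i j
setOne-mono i j M⊑M' i' j' p with does (i ≟ i') ∧ does (j ≟ j')
... | true  = refl
... | false = M⊑M' i' j' p

⊑-setOne : ∀ {m n} (M : Matrix m n) i j → M ⊑ setOne M i j
⊑-setOne M i j i' j' p with does (i ≟ i') ∧ does (j ≟ j')
... | true  = refl
... | false = p

setOne-self : ∀ {m n} (M : Matrix m n) i j → setOne M i j i j ≡ true
setOne-self M i j rewrite dec-true (i ≟ i) refl | dec-true (j ≟ j) refl = refl

setOne-⊑ : ∀ {m n} {M F : Matrix m n} i j → M ⊑ F → F i j ≡ true → setOne M i j ⊑ F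
setOne-⊑ i j M⊑F Fij≡1 i' j' p with i ≟ i' | j ≟ j'
... | yes refl | yes refl = Fij≡1
... | yes refl | no _     = M⊑F i' j' p
... | no _     | yes _    = M⊑F i' j' p
... | no _     | no _     = M⊑F i' j' p

module _ {k l} (P : Matrix k l) where

  Settled : ∀ {m n} → Matrix m n → Fin m × Fin n → Set
  Settled M (i , j) = M i j ≡ true ⊎ Contains (setOne M i j) P

  Settled-mono : ∀ {m n} {M M' : Matrix m n} x → M ⊑ M' → Settled M x → Settled M' x
  Settled-mono (i , j) M⊑M' (inj₁ Mij≡1) = inj₁ (M⊑M' i j Mij≡1)
  Settled-mono (i , j) M⊑M' (inj₂ c)     = inj₂ (Contains-mono (setOne-mono i j M⊑M') c)

  all-settled⇒Saturating : ∀ {m n} {F : Matrix m n} →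
    Avoids F P → (∀ x → Settled F x) → Saturating P F
  all-settled⇒Saturating {F = F} avoids settled = avoids , saturated
    where
    saturated : ∀ i j → F i j ≡ false → Contains (setOne F i j) P
    saturated i j Fij≡0 with settled (i , j)
    ... | inj₁ Fij≡1 with () ← trans (sym Fij≡0) Fij≡1
    ... | inj₂ c     = c

  module _ {m n : ℕ} where

    fill : Matrix m n → Fin m × Fin n → Matrix m n
    fill M (i , j) with contains? (setOne M i j) P
    ... | yes _ = M
    ... | no _  = setOne M i j

    fill-avoids : ∀ M x → Avoids M P → Avoids (fill M x) P
    fill-avoids M (i , j) avoids with contains? (setOne M i j) P
    ... | yes _ = avoids
    ... | no ¬c = ¬c

    ⊑-fill : ∀ M x → M ⊑ fill M x
    ⊑-fill M (i , j) with contains? (setOne M i j) P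
    ... | yes _ = ⊑-refl
    ... | no _  = ⊑-setOne M i j

    fill-settled : ∀ M x → Settled (fill M x) x
    fill-settled M (i , j) with contains? (setOne M i j) P
    ... | yes c = inj₂ c
    ... | no _  = inj₁ (setOne-self M i j)

    fillAll : Matrix m n → List (Fin m × Fin n) → Matrix m n
    fillAll M []       = M
    fillAll M (x ∷ xs) = fillAll (fill M x) xs

    fillAll-avoids : ∀ M xs → Avoids M P → Avoids (fillAll M xs) P
    fillAll-avoids M []       avoids = avoids
    fillAll-avoids M (x ∷ xs) avoids = fillAll-avoids (fill M x) xs (fill-avoids M x avoids)

    ⊑-fillAll : ∀ M xs → M ⊑ fillAll M xs
    ⊑-fillAll M []       = ⊑-refl
    ⊑-fillAll M (x ∷ xs) = ⊑-trans (⊑-fill M x) (⊑-fillAll (fill M x) xs)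

    fillAll-settled : ∀ M xs {x} → x ∈ xs → Settled (fillAll M xs) x
    fillAll-settled M (x ∷ xs) (here refl) =
      Settled-mono x (⊑-fillAll (fill M x) xs) (fill-settled M x)
    fillAll-settled M (y ∷ xs) (there x∈xs) = fillAll-settled (fill M y) xs x∈xs

    saturation : ∀ M → Avoids M P → Σ (Matrix m n) λ F → M ⊑ F × Saturating P F
    saturation M avoids =
      F , ⊑-fillAll M cells ,
      all-settled⇒Saturating (fillAll-avoids M cells avoids)
        λ (i , j) → fillAll-settled M cells (∈-cartesianProduct⁺ (∈-allFin i) (∈-allFin j))
      where
      cells : List (Fin m × Fin n)
      cells = cartesianProduct (allFin m) (allFin n)
      F : Matrix m n
      F = fillAll M cells

  forced⇒false : ∀ {m n} {M F : Matrix m n} → M ⊑ F → Avoids F P →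
    ∀ i j → Contains (setOne M i j) P → F i j ≡ false
  forced⇒false {F = F} M⊑F avoids i j c with F i j in Fij
  ... | false = refl
  ... | true  = ⊥-elim (avoids (Contains-mono (setOne-⊑ i j M⊑F Fij) c))

lemma1p3 : ∀ {k l} (P : Matrix k l) → IsPattern P → NoEmptyRows P → NoEmptyCols P →
    (m₀ n₀ : ℕ) → (M : Matrix m₀ n₀) → Witness P M →
    Σ (Matrix m₀ n₀) (ExplicitWitness P)
lemma1p3 P _ _ _ m₀ n₀ M (avoids , (i₀ , _ , row-forced) , (j₀ , _ , col-forced))
  with saturation P M avoids
... | F , M⊑F , saturating@(F-avoids , _) =
  F , saturating ,
  (i₀ , λ j → forced⇒false P M⊑F F-avoids i₀ j (row-forced j)) ,
  (j₀ , λ i → forced⇒false P M⊑F F-avoids i j₀ (col-forced i))
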